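{- (i) With $G = \langle 43215 \rangle \le S_5$ ($\cong C_2$), the union of the 9 distinct left cosets $\pi G$, $\pi \in \{12345, 12435, 13452, 15324, 21543, 23514, 24513, 51423, 52314\}$, is a ${\rm PSCA}(5,3,3)$. (ii) With $G = \langle 634215, 456123 \rangle \le S_6$ ($\cong S_3$), the union of the 3 distinct left cosets $\pi G$, $\pi \in \{123456, 134265, 162435\}$, is a ${\rm PSCA}(6,3,3)$. (iii) With $G = \langle 3412765 \rangle \le S_7$ ($\cong C_2$), the union of the 9 distinct left cosets $\pi G$, $\pi \in \{1234567, 1253764, 1643572, 5147362, 5241673, 5276341, 5432617, 6175324, 6245371\}$, is a ${\rm PSCA}(7,3,3)$. (iv) With $G = \langle 1576342 \rangle \le S_7$ ($\cong C_4$), the union of the 18 distinct left cosets $\pi G$, $\pi \in \{1234567, 1256437, 2136754, 2164573, 2315476, 2436751, 2537614, 2574613, 2716354, 2741536, 2764351, 4127356, 4162753, 4251673, 4263175, 4523716, 4536172, 4576312\}$, is a ${\rm PSCA}(7,4,3)$. (v) With $G = \langle 67142358, 46572381 \rangle \le S_8$ ($\cong {\rm SL}(2,3)$), the single left coset $12354678\,G$ (24 sequences) is a ${\rm PSCA}(8,3,4)$. (vi) With $G = \langle 65872143, 45712836 \rangle \le S_8$ ($\cong S_3$), the union of the 5 distinct left cosets $\pi G$, $\pi \in \{12345678, 12485736, 17384625, 17564823, 21685347\}$, is a ${\rm PSCA}(8,3,5)$.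
   Context: $S_n$ is the symmetric group on $[n]=\{1,\dots,n\}$, each permutation $x$ written as the sequence $x(1)x(2)\cdots x(n)$ of its values. Composition convention: $\pi\sigma$ means $\pi$ followed by $\sigma$, so the sequence of $\pi\sigma$ is $\sigma(\pi(1))\cdots\sigma(\pi(n))$; a left coset is $\pi G = \{\pi g : g \in G\}$, and $\langle \cdot \rangle$ denotes the subgroup generated. $S_{n,k}$ is the set of sequences of $k$ distinct elements of $[n]$; $x\in S_n$ covers $y \in S_{n,k}$ if $y$ is a (not necessarily contiguous) subsequence of $x$. A ${\rm PSCA}(n,k,\lambda)$ is a multiset $P$ of elements of $S_n$ such that every $y \in S_{n,k}$ is covered by exactly $\lambda$ elements of $P$, counted with multiplicity. -}

module Defs where

open import Data.Nat using (ℕ; zero; suc; _∸_)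
open import Data.Fin using (Fin; zero; suc)
open import Data.Fin.Properties using () renaming (_≟_ to _≟ᶠ_)
open import Data.Vec using (Vec; []; _∷_; map; lookup; tabulate; toList)
open import Data.List using (List; length; filter)
open import Data.List.Membership.Propositional using (_∈_)
open import Data.List.Relation.Unary.All using (All)
open import Data.List.Relation.Unary.AllPairs using (AllPairs)
open import Data.List.Relation.Unary.Unique.Propositional using (Unique)
open import Data.Product using (Σ; ∃; _×_; _,_)
open import Function.Bundles using (_⇔_)
open import Relation.Nullary using (¬_)
open import Relation.Binary.PropositionalEquality using (_≡_)
import Data.List.Relation.Binary.Sublist.DecPropositional as SubDec

-- A sequence of length k with values in [n] (values 1..n are represented
-- by Fin n, i.e. value v is stored as v-1).
Seq : ℕ → ℕ → Set
Seq n k = Vec (Fin n) k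

-- Elements of S_n written as the sequence x(1)…x(n); an element of S_n is
-- a sequence of n distinct values.
Word : ℕ → Set
Word n = Seq n n

Distinct : ∀ {n k} → Seq n k → Set
Distinct y = Unique (toList y)

InS : ∀ {n} → Word n → Set
InS x = Distinct x

module _ {n : ℕ} where
  open SubDec (_≟ᶠ_ {n}) using (_⊆_; _⊆?_)

  Covers : ∀ {k} → Word n → Seq n k → Set
  Covers x y = toList y ⊆ toList x

  coverCount : ∀ {k} → List (Word n) → Seq n k → ℕ
  coverCount P y = length (filter (λ x → toList y ⊆? toList x) P)

PSCA : (n k λ' : ℕ) → List (Word n) → Set
PSCA n k λ' P = All InS P × (∀ (y : Seq n k) → Distinct y → coverCount P y ≡ λ')

-- Composition πσ = π followed by σ: its sequence is σ(π(1))…σ(π(n)).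
_∘ₚ_ : ∀ {n} → Word n → Word n → Word n
π ∘ₚ σ = map (lookup σ) π

idₚ : ∀ {n} → Word n
idₚ = tabulate (λ i → i)

data ⟨_⟩ {n : ℕ} (gens : List (Word n)) : Word n → Set where
  gen : ∀ {s} → s ∈ gens → ⟨ gens ⟩ s
  one : ⟨ gens ⟩ idₚ
  mul : ∀ {x y} → ⟨ gens ⟩ x → ⟨ gens ⟩ y → ⟨ gens ⟩ (x ∘ₚ y)
  inv : ∀ {x y} → ⟨ gens ⟩ x → x ∘ₚ y ≡ idₚ → ⟨ gens ⟩ y

InCoset : ∀ {n} → List (Word n) → Word n → Word n → Set
InCoset gens π x = ∃ λ g → ⟨ gens ⟩ g × x ≡ π ∘ₚ g

InUnion : ∀ {n} → List (Word n) → List (Word n) → Word n → Set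
InUnion gens πs x = ∃ λ π → π ∈ πs × InCoset gens π x

CosetUnionPSCA : (n k λ' : ℕ) → (gens πs : List (Word n)) → Set
CosetUnionPSCA n k λ' gens πs =
  AllPairs (λ π σ → ¬ InCoset gens π σ) πs ×
  Σ (List (Word n)) (λ L →
    Unique L × (∀ x → (x ∈ L) ⇔ InUnion gens πs x) × PSCA n k λ' L)

-- Writing permutations in one-line 1-based notation: value v ↦ Fin index v-1.
clamp : (m : ℕ) → ℕ → Fin (suc m)
clamp m zero = zero
clamp zero (suc _) = zero
clamp (suc m) (suc k) = suc (clamp m k)

w : ∀ {m} → Vec ℕ (suc m) → Word (suc m)
w {m} v = map (λ a → clamp m (a ∸ 1)) v

-- Every part is a finite check. Saturating the generators under right multiplication
-- enumerates G; a list of words that contains the generators and is closed under products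
-- and left inverses contains all of ⟨ gens ⟩, so it is G, the coset union is an explicit
-- list, and coverage is decided by running through all of [n]^k.

module Submission where

open import Defs
open import Data.Bool using (if_then_else_)
open import Data.Fin.Properties using () renaming (_≟_ to _≟ᶠ_; all? to allFin?)
open import Data.List using (List; []; _∷_; _++_; map; concatMap; cartesianProductWith; deduplicate; length)
open import Data.List.Membership.Propositional using (_∈_; mapWith∈; find; lose)
open import Data.List.Membership.Propositional.Properties using (∈-map⁺; ∈-map⁻; ∈-concatMap⁺; ∈-concatMap⁻)
import Data.List.Membership.DecPropositional as DecMembership
open import Data.List.Relation.Unary.All as All using (All)
open import Data.List.Relation.Unary.Any as Any using (Any)
open import Data.List.Relation.Unary.AllPairs as AllPairs using (AllPairs)
open import Data.List.Relation.Unary.Unique.Propositional using (Unique)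
open import Data.List.Relation.Unary.Unique.DecPropositional using (unique?)
open import Data.Nat using (ℕ; zero; suc; _≡ᵇ_; _!) renaming (_≟_ to _≟ⁿ_)
open import Data.Product using (Σ; _×_; _,_; proj₁)
open import Data.Vec using ([]; _∷_; lookup; toList)
import Data.Vec.Properties as Vec
open import Function using (_∘_; id)
open import Function.Bundles using (mk⇔)
open import Relation.Binary.Definitions using (DecidableEquality)
open import Relation.Binary.PropositionalEquality using (_≡_; _≢_; refl; sym; trans; cong; module ≡-Reasoning)
open import Relation.Nullary using (¬_; Dec)
open import Relation.Nullary.Decidable using (True; toWitness; map′; ¬?; _×-dec_; _→-dec_)

infix 4 _≟ʷ_

_≟ʷ_ : ∀ {n} → DecidableEquality (Word n)
_≟ʷ_ = Vec.≡-dec _≟ᶠ_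

∘ₚ-identityˡ : ∀ {n} (x : Word n) → idₚ ∘ₚ x ≡ x
∘ₚ-identityˡ x = trans (sym (Vec.tabulate-∘ (lookup x) id)) (Vec.tabulate∘lookup x)

∘ₚ-identityʳ : ∀ {n} (x : Word n) → x ∘ₚ idₚ ≡ x
∘ₚ-identityʳ x = trans (Vec.map-cong (Vec.lookup∘tabulate id) x) (Vec.map-id x)

∘ₚ-assoc : ∀ {n} (x y z : Word n) → (x ∘ₚ y) ∘ₚ z ≡ x ∘ₚ (y ∘ₚ z)
∘ₚ-assoc x y z = trans (sym (Vec.map-∘ (lookup z) (lookup y) x))
                       (Vec.map-cong (λ i → sym (Vec.lookup-map i (lookup z) y)) x)

leftInverse≡rightInverse : ∀ {n} {x l r : Word n} → l ∘ₚ x ≡ idₚ → x ∘ₚ r ≡ idₚ → r ≡ l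
leftInverse≡rightInverse {x = x} {l} {r} lx≡id xr≡id = begin
  r               ≡⟨ sym (∘ₚ-identityˡ r) ⟩
  idₚ ∘ₚ r        ≡⟨ cong (_∘ₚ r) (sym lx≡id) ⟩
  (l ∘ₚ x) ∘ₚ r   ≡⟨ ∘ₚ-assoc l x r ⟩
  l ∘ₚ (x ∘ₚ r)   ≡⟨ cong (l ∘ₚ_) xr≡id ⟩
  l ∘ₚ idₚ        ≡⟨ ∘ₚ-identityʳ l ⟩
  l               ∎
  where open ≡-Reasoning

∀-Seq? : ∀ {n} k {P : Seq n k → Set} → (∀ y → Dec (P y)) → Dec (∀ y → P y)
∀-Seq? zero    P? = map′ (λ { p [] → p }) (λ ∀P → ∀P []) (P? [])
∀-Seq? (suc k) P? = map′ (λ ∀P → λ { (i ∷ y) → ∀P i y }) (λ ∀P i y → ∀P (i ∷ y))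
                         (allFin? λ i → ∀-Seq? k (P? ∘ (i ∷_)))

psca? : ∀ n k λ' (P : List (Word n)) → Dec (PSCA n k λ' P)
psca? n k λ' P =
  All.all? (unique? _≟ᶠ_ ∘ toList) P
  ×-dec ∀-Seq? k (λ y → unique? _≟ᶠ_ (toList y) →-dec (coverCount P y ≟ⁿ λ'))

module _ {n : ℕ} (gens : List (Word n)) where

  open DecMembership (_≟ʷ_ {n}) using (_∈?_)

  IsClosed : List (Word n) → Set
  IsClosed L = All (_∈ L) gens × idₚ ∈ L
             × All (λ x → All (λ y → x ∘ₚ y ∈ L) L) L
             × All (λ x → Any (λ y → y ∘ₚ x ≡ idₚ) L) L

  isClosed? : ∀ L → Dec (IsClosed L)
  isClosed? L = All.all? (_∈? L) gens ×-dec idₚ ∈? L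
              ×-dec All.all? (λ x → All.all? (λ y → x ∘ₚ y ∈? L) L) L
              ×-dec All.all? (λ x → Any.any? (λ y → y ∘ₚ x ≟ʷ idₚ) L) L

  ⟨⟩⊆closed : ∀ {L} → IsClosed L → ∀ {g} → ⟨ gens ⟩ g → g ∈ L
  ⟨⟩⊆closed (gens⊆L , _ , _ , _) (gen s∈gens) = All.lookup gens⊆L s∈gens
  ⟨⟩⊆closed (_ , id∈L , _ , _) one = id∈L
  ⟨⟩⊆closed c@(_ , _ , mul-closed , _) (mul p q) =
    All.lookup (All.lookup mul-closed (⟨⟩⊆closed c p)) (⟨⟩⊆closed c q)
  ⟨⟩⊆closed c@(_ , _ , _ , inverses) (inv p xr≡id) =
    let l , l∈L , lx≡id = find (All.lookup inverses (⟨⟩⊆closed c p))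
    in Any.map (λ { refl → leftInverse≡rightInverse lx≡id xr≡id }) l∈L

  Element : Set
  Element = Σ (Word n) ⟨ gens ⟩

  _·_ : Element → Element → Element
  (x , p) · (y , q) = x ∘ₚ y , mul p q

  grow : List Element → List Element
  grow L = deduplicate (λ x y → proj₁ x ≟ʷ proj₁ y)
             (L ++ cartesianProductWith _·_ L (mapWith∈ gens (λ s∈gens → _ , gen s∈gens)))

  saturate : ℕ → List Element → List Element
  saturate zero    L = L
  saturate (suc f) L = continue (grow L)
    where
    continue : List Element → List Element
    continue L′ = if length L′ ≡ᵇ length L then L else saturate f L′

  -- The fuel only bounds the search: that the result is all of ⟨ gens ⟩ is checked by isClosed?.
  elements : List (Word n)
  elements = map proj₁ (saturate (n !) ((idₚ , one) ∷ []))

  elements⊆⟨⟩ : ∀ {g} → g ∈ elements → ⟨ gens ⟩ g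
  elements⊆⟨⟩ g∈ with ∈-map⁻ proj₁ g∈
  ... | (_ , p) , _ , refl = p

  cosetUnion : List (Word n) → List (Word n)
  cosetUnion = concatMap (λ π → map (π ∘ₚ_) elements)

  ∈cosetUnion⇒InUnion : ∀ {πs x} → x ∈ cosetUnion πs → InUnion gens πs x
  ∈cosetUnion⇒InUnion {πs} x∈ with find (∈-concatMap⁻ (λ π → map (π ∘ₚ_) elements) {xs = πs} x∈)
  ... | π , π∈πs , x∈πG with ∈-map⁻ (π ∘ₚ_) x∈πG
  ... | g , g∈ , refl = π , π∈πs , g , elements⊆⟨⟩ g∈ , refl

  InUnion⇒∈cosetUnion : IsClosed elements → ∀ {πs x} → InUnion gens πs x → x ∈ cosetUnion πs
  InUnion⇒∈cosetUnion closed (π , π∈πs , g , p , refl) =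
    ∈-concatMap⁺ _ (lose π∈πs (∈-map⁺ (π ∘ₚ_) (⟨⟩⊆closed closed p)))

  Apart : Word n → Word n → Set
  Apart π σ = All (λ g → σ ≢ π ∘ₚ g) elements

  apart⇒∉coset : IsClosed elements → ∀ {π σ} → Apart π σ → ¬ InCoset gens π σ
  apart⇒∉coset closed apart (g , p , σ≡πg) = All.lookup apart (⟨⟩⊆closed closed p) σ≡πg

  Certificate : ℕ → ℕ → List (Word n) → Set
  Certificate k λ' πs = IsClosed elements × AllPairs Apart πs
                      × Unique (cosetUnion πs) × PSCA n k λ' (cosetUnion πs)

  certificate? : ∀ k λ' πs → Dec (Certificate k λ' πs)
  certificate? k λ' πs = isClosed? elements
    ×-dec AllPairs.allPairs? (λ π σ → All.all? (λ g → ¬? (σ ≟ʷ π ∘ₚ g)) elements) πs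
    ×-dec unique? _≟ʷ_ (cosetUnion πs)
    ×-dec psca? n k λ' (cosetUnion πs)

  certificate⇒CosetUnionPSCA : ∀ {k λ' πs} → Certificate k λ' πs → CosetUnionPSCA n k λ' gens πs
  certificate⇒CosetUnionPSCA (closed , apart , unique , psca) =
    AllPairs.map (apart⇒∉coset closed) apart , _ , unique ,
    (λ _ → mk⇔ ∈cosetUnion⇒InUnion (InUnion⇒∈cosetUnion closed)) , psca

cosetUnionPSCA : ∀ {n k λ'} {gens πs : List (Word n)} →
                 {True (certificate? gens k λ' πs)} → CosetUnionPSCA n k λ' gens πs
cosetUnionPSCA {gens = gens} {πs} {ok} = certificate⇒CosetUnionPSCA gens (toWitness ok)

proposition4p9 : CosetUnionPSCA 5 3 3
    (w (4 ∷ 3 ∷ 2 ∷ 1 ∷ 5 ∷ []) ∷ [])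
    (w (1 ∷ 2 ∷ 3 ∷ 4 ∷ 5 ∷ []) ∷ w (1 ∷ 2 ∷ 4 ∷ 3 ∷ 5 ∷ []) ∷ w (1 ∷ 3 ∷ 4 ∷ 5 ∷ 2 ∷ []) ∷ w (1 ∷ 5 ∷ 3 ∷ 2 ∷ 4 ∷ []) ∷ w (2 ∷ 1 ∷ 5 ∷ 4 ∷ 3 ∷ []) ∷ w (2 ∷ 3 ∷ 5 ∷ 1 ∷ 4 ∷ []) ∷ w (2 ∷ 4 ∷ 5 ∷ 1 ∷ 3 ∷ []) ∷ w (5 ∷ 1 ∷ 4 ∷ 2 ∷ 3 ∷ []) ∷ w (5 ∷ 2 ∷ 3 ∷ 1 ∷ 4 ∷ []) ∷ [])
    × CosetUnionPSCA 6 3 3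
    (w (6 ∷ 3 ∷ 4 ∷ 2 ∷ 1 ∷ 5 ∷ []) ∷ w (4 ∷ 5 ∷ 6 ∷ 1 ∷ 2 ∷ 3 ∷ []) ∷ [])
    (w (1 ∷ 2 ∷ 3 ∷ 4 ∷ 5 ∷ 6 ∷ []) ∷ w (1 ∷ 3 ∷ 4 ∷ 2 ∷ 6 ∷ 5 ∷ []) ∷ w (1 ∷ 6 ∷ 2 ∷ 4 ∷ 3 ∷ 5 ∷ []) ∷ [])
    × CosetUnionPSCA 7 3 3
    (w (3 ∷ 4 ∷ 1 ∷ 2 ∷ 7 ∷ 6 ∷ 5 ∷ []) ∷ [])
    (w (1 ∷ 2 ∷ 3 ∷ 4 ∷ 5 ∷ 6 ∷ 7 ∷ []) ∷ w (1 ∷ 2 ∷ 5 ∷ 3 ∷ 7 ∷ 6 ∷ 4 ∷ []) ∷ w (1 ∷ 6 ∷ 4 ∷ 3 ∷ 5 ∷ 7 ∷ 2 ∷ []) ∷ w (5 ∷ 1 ∷ 4 ∷ 7 ∷ 3 ∷ 6 ∷ 2 ∷ []) ∷ w (5 ∷ 2 ∷ 4 ∷ 1 ∷ 6 ∷ 7 ∷ 3 ∷ []) ∷ w (5 ∷ 2 ∷ 7 ∷ 6 ∷ 3 ∷ 4 ∷ 1 ∷ []) ∷ w (5 ∷ 4 ∷ 3 ∷ 2 ∷ 6 ∷ 1 ∷ 7 ∷ []) ∷ w (6 ∷ 1 ∷ 7 ∷ 5 ∷ 3 ∷ 2 ∷ 4 ∷ []) ∷ w (6 ∷ 2 ∷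 4 ∷ 5 ∷ 3 ∷ 7 ∷ 1 ∷ []) ∷ [])
    × CosetUnionPSCA 7 4 3
    (w (1 ∷ 5 ∷ 7 ∷ 6 ∷ 3 ∷ 4 ∷ 2 ∷ []) ∷ [])
    (w (1 ∷ 2 ∷ 3 ∷ 4 ∷ 5 ∷ 6 ∷ 7 ∷ []) ∷ w (1 ∷ 2 ∷ 5 ∷ 6 ∷ 4 ∷ 3 ∷ 7 ∷ []) ∷ w (2 ∷ 1 ∷ 3 ∷ 6 ∷ 7 ∷ 5 ∷ 4 ∷ []) ∷ w (2 ∷ 1 ∷ 6 ∷ 4 ∷ 5 ∷ 7 ∷ 3 ∷ []) ∷ w (2 ∷ 3 ∷ 1 ∷ 5 ∷ 4 ∷ 7 ∷ 6 ∷ []) ∷ w (2 ∷ 4 ∷ 3 ∷ 6 ∷ 7 ∷ 5 ∷ 1 ∷ []) ∷ w (2 ∷ 5 ∷ 3 ∷ 7 ∷ 6 ∷ 1 ∷ 4 ∷ []) ∷ w (2 ∷ 5 ∷ 7 ∷ 4 ∷ 6 ∷ 1 ∷ 3 ∷ []) ∷ w (2 ∷ 7 ∷ 1 ∷ 6 ∷ 3 ∷ 5 ∷ 4 ∷ []) ∷ w (2 ∷ 7 ∷ 4 ∷ 1 ∷ 5 ∷ 3 ∷ 6 ∷ []) ∷ w (2 ∷ 7 ∷ 6 ∷ 4 ∷ 3 ∷ 5 ∷ 1 ∷ []) ∷ w (4 ∷ 1 ∷ 2 ∷ 7 ∷ 3 ∷ 5 ∷ 6 ∷ []) ∷ w (4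 ∷ 1 ∷ 6 ∷ 2 ∷ 7 ∷ 5 ∷ 3 ∷ []) ∷ w (4 ∷ 2 ∷ 5 ∷ 1 ∷ 6 ∷ 7 ∷ 3 ∷ []) ∷ w (4 ∷ 2 ∷ 6 ∷ 3 ∷ 1 ∷ 7 ∷ 5 ∷ []) ∷ w (4 ∷ 5 ∷ 2 ∷ 3 ∷ 7 ∷ 1 ∷ 6 ∷ []) ∷ w (4 ∷ 5 ∷ 3 ∷ 6 ∷ 1 ∷ 7 ∷ 2 ∷ []) ∷ w (4 ∷ 5 ∷ 7 ∷ 6 ∷ 3 ∷ 1 ∷ 2 ∷ []) ∷ [])
    × CosetUnionPSCA 8 3 4
    (w (6 ∷ 7 ∷ 1 ∷ 4 ∷ 2 ∷ 3 ∷ 5 ∷ 8 ∷ []) ∷ w (4 ∷ 6 ∷ 5 ∷ 7 ∷ 2 ∷ 3 ∷ 8 ∷ 1 ∷ []) ∷ [])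
    (w (1 ∷ 2 ∷ 3 ∷ 5 ∷ 4 ∷ 6 ∷ 7 ∷ 8 ∷ []) ∷ [])
    × CosetUnionPSCA 8 3 5
    (w (6 ∷ 5 ∷ 8 ∷ 7 ∷ 2 ∷ 1 ∷ 4 ∷ 3 ∷ []) ∷ w (4 ∷ 5 ∷ 7 ∷ 1 ∷ 2 ∷ 8 ∷ 3 ∷ 6 ∷ []) ∷ [])
    (w (1 ∷ 2 ∷ 3 ∷ 4 ∷ 5 ∷ 6 ∷ 7 ∷ 8 ∷ []) ∷ w (1 ∷ 2 ∷ 4 ∷ 8 ∷ 5 ∷ 7 ∷ 3 ∷ 6 ∷ []) ∷ w (1 ∷ 7 ∷ 3 ∷ 8 ∷ 4 ∷ 6 ∷ 2 ∷ 5 ∷ []) ∷ w (1 ∷ 7 ∷ 5 ∷ 6 ∷ 4 ∷ 8 ∷ 2 ∷ 3 ∷ []) ∷ w (2 ∷ 1 ∷ 6 ∷ 8 ∷ 5 ∷ 3 ∷ 4 ∷ 7 ∷ []) ∷ [])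
proposition4p9 = cosetUnionPSCA , cosetUnionPSCA , cosetUnionPSCA , cosetUnionPSCA , cosetUnionPSCA , cosetUnionPSCA
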